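{- Consider the \textsc{Normal Domination Game} and let $n\geq 3$. The nimber of the cycle $C_n$ is $1$ if $n \bmod 4 = 3$, and is $0$ otherwise. Consequently, Alice (the first player) wins the \textsc{Normal Domination Game} on $C_n$ if and only if $n \bmod 4 = 3$.
   Context: $C_n$ is the cycle on $n$ vertices. A vertex dominates itself and its neighbors. In the \textsc{Normal Domination Game} on a graph, Alice (first) and Bob alternately select playable vertices, where a vertex is playable if it dominates at least one vertex not dominated by previously selected vertices; the game ends when no vertex is playable, and the last player to move wins. The nimber (Sprague–Grundy value) of a position is the minimum excludant (least non-negative integer not in the set) of the nimbers of positions reachable in one move; a position with no moves has nimber $0$. -}

module Defs where

open import Data.Nat using (ℕ; zero; suc; _+_; _%_; _≡ᵇ_)
open import Data.Bool using (Bool; true; false; not; _∧_; _∨_; if_then_else_)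
open import Data.Fin using (Fin; toℕ)
open import Data.List using (List; []; _∷_; map; allFin; length)
open import Data.Bool.ListAction using (any)

Graph : ℕ → Set
Graph n = Fin n → Fin n → Bool

cycle : (n : ℕ) → Graph n
cycle (suc n) i j =
  ((suc (toℕ i) % suc n) ≡ᵇ toℕ j) ∨ ((suc (toℕ j) % suc n) ≡ᵇ toℕ i)
cycle zero () j

dominates : ∀ {n} → Graph n → Fin n → Fin n → Bool
dominates G v u = (toℕ v ≡ᵇ toℕ u) ∨ G v u

-- A position of the game is determined by the set of vertices dominated by
-- the previously selected vertices (as a characteristic function).
Position : ℕ → Set
Position n = Fin n → Bool

start : ∀ {n} → Position n
start _ = false

playable : ∀ {n} → Graph n → Position n → Fin n → Bool
playable {n} G D v = any (λ u → dominates G v u ∧ not (D u)) (allFin n)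

play : ∀ {n} → Graph n → Position n → Fin n → Position n
play G D v u = D u ∨ dominates G v u

moves : ∀ {n} → Graph n → Position n → List (Fin n)
moves {n} G D = filterB (playable G D) (allFin n)
  where
  filterB : (Fin n → Bool) → List (Fin n) → List (Fin n)
  filterB p [] = []
  filterB p (x ∷ xs) = if p x then x ∷ filterB p xs else filterB p xs

elem : ℕ → List ℕ → Bool
elem k [] = false
elem k (x ∷ xs) = (k ≡ᵇ x) ∨ elem k xs

mexFrom : ℕ → ℕ → List ℕ → ℕ
mexFrom zero k xs = k
mexFrom (suc f) k xs = if elem k xs then mexFrom f (suc k) xs else k

mex : List ℕ → ℕ
mex xs = mexFrom (length xs) 0 xs

-- Every move strictly
-- enlarges the dominated set, so the game from any position of a graph on
-- n vertices lasts at most n moves; with bound ≥ n+1 the recursion is exact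
-- (at bound 0 we never recurse from a position with moves when the bound is
-- large enough).
nimberB : ∀ {n} → ℕ → Graph n → Position n → ℕ
nimberB zero G D = 0
nimberB (suc f) G D = mex (map (λ v → nimberB f G (play G D v)) (moves G D))

nimber : ∀ {n} → Graph n → Position n → ℕ
nimber {n} G D = nimberB (suc n) G D

winsB : ∀ {n} → ℕ → Graph n → Position n → Bool
winsB zero G D = false
winsB (suc f) G D = any (λ v → not (winsB f G (play G D v))) (moves G D)

playerToMoveWins : ∀ {n} → Graph n → Position n → Bool
playerToMoveWins {n} G D = winsB (suc n) G D

gameNimber : ∀ {n} → Graph n → ℕ
gameNimber G = nimber G start

AliceWins : ∀ {n} → Graph n → Set
AliceWins G = playerToMoveWins G start ≡ true
  where open import Relation.Binary.PropositionalEquality using (_≡_)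

{-# OPTIONS --safe #-}

-- Cut the cycle open at a vertex.  Once some vertices are dominated, the undominated ones form
-- runs; while any two runs are separated by at least two dominated vertices, no vertex touches two
-- runs, so the runs are independent games.  A move turns a run of length k into one of length
-- k − 1 or k − 2 (cutting at an end) or into two runs a, b with a + b = k − 3.  Valuing a run by
-- k mod 4, each option changes the value (for the split because a ⊕ b and a + b + 3 have different
-- parities), and the options k − 1, k − 2, k − 3 reach every smaller residue.  Hence, by the usual
-- nim argument checked directly against the mex recursion, a position has as nimber the nim-sum of
-- its run lengths mod 4.  By rotational symmetry every first move on Cₙ leaves one run of n − 3
-- vertices, so Cₙ has nimber mex {(n − 3) mod 4}, which is 1 if n mod 4 = 3 and 0 otherwise.

module Submission where

open import Defs
open import Data.Nat using (ℕ; _≤_; _%_)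
open import Data.Product using (_×_)
open import Relation.Binary.PropositionalEquality using (_≡_)
open import Relation.Nullary using (¬_)
open import Function.Bundles using (_⇔_)

open import Data.Bool using (Bool; true; false; not; _∧_; _∨_; _xor_; T; T?)
open import Data.Bool.ListAction using (any; or)
open import Data.Bool.Properties
  using ( xor-assoc; xor-comm; xor-same; xor-identityʳ; not-distribˡ-xor; not-distribʳ-xor; not-¬; not-involutive
        ; T-≡; T-∨; T-∧; T-not-≡; ¬-not; ∨-zeroʳ; ∨-identityʳ; ⇔→≡)
open import Data.Empty using (⊥; ⊥-elim)
open import Data.Fin using (Fin; zero; suc; toℕ; fromℕ; fromℕ<; inject₁)
open import Data.Fin.Properties using (toℕ-fromℕ; toℕ-fromℕ<; fromℕ<-toℕ; toℕ<n; toℕ-injective; toℕ-inject₁; pigeonhole)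
open import Data.List using (List; []; _∷_; _++_; map; length; replicate; tabulate; allFin; filterᵇ)
open import Data.List.Membership.Propositional using (_∈_; _∉_; lose)
open import Data.List.Membership.Propositional.Properties using (∈-filter⁺; ∈-filter⁻; ∈-map⁺; ∈-map⁻; ∈-allFin)
open import Data.List.Membership.Setoid.Properties using (index-injective)
open import Data.List.Properties using (map-cong; map-∘; length-++; length-tabulate; length-replicate; ∷-injectiveˡ; ∷-injectiveʳ)
open import Data.List.Relation.Binary.Subset.Propositional using (_⊆_)
open import Data.List.Relation.Unary.Any as Any using (here; there; index; satisfied)
open import Data.List.Relation.Unary.Any.Properties using (any⁺; any⁻; any⇔)
open import Data.Nat using (zero; suc; _+_; _<_; _≤ᵇ_; _≡ᵇ_; z≤n; s≤s; s≤s⁻¹; _≤?_; _≟_)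
open import Data.Nat.DivMod using ([m+n]%n≡m%n; m<n⇒m%n≡m; n%n≡0; m%n<n)
open import Data.Nat.Properties
  using ( +-comm; +-suc; +-identityʳ; +-commutativeSemigroup; suc-injective
        ; ≤-refl; ≤-reflexive; ≤-trans; ≤-<-trans; ≤-pred; <⇒≱; ≰⇒>; <⇒≢; <-irrefl; <-cmp; 1+n≰n; n≮0
        ; n≤1+n; m≤n+m; m≤n⇒m<n∨m≡n; <⇒<ᵇ; ≡ᵇ⇒≡; ≡⇒≡ᵇ)
open import Data.Product using (∃; ∃₂; _,_; proj₁; proj₂)
open import Data.Sum using (_⊎_; inj₁; inj₂)
open import Function.Base using (_∘_)
open import Function.Bundles using (mk⇔; Equivalence)
open import Function.Construct.Composition using (_⇔-∘_)
open import Relation.Binary.Definitions using (tri<; tri≈; tri>)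
open import Relation.Binary.PropositionalEquality
  using (_≢_; refl; sym; trans; cong; cong₂; subst; ≢-sym; setoid; module ≡-Reasoning)
open import Relation.Nullary using (yes; no; contradiction)

open import Algebra.Properties.CommutativeSemigroup +-commutativeSemigroup using (x∙yz≈y∙xz)

-- Nimbers below 4

-- stored as binary digits (twos , ones), so that nim-addition is digitwise xor
Nim₄ : Set
Nim₄ = Bool × Bool

0₄ : Nim₄
0₄ = false , false

infixl 6 _⊕_
_⊕_ : Nim₄ → Nim₄ → Nim₄
x ⊕ y = proj₁ x xor proj₁ y , proj₂ x xor proj₂ y

toℕ₄ : Nim₄ → ℕ
toℕ₄ (false , false) = 0
toℕ₄ (false , true)  = 1
toℕ₄ (true  , false) = 2
toℕ₄ (true  , true)  = 3

fromℕ₄ : ℕ → Nim₄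
fromℕ₄ 0 = false , false
fromℕ₄ 1 = false , true
fromℕ₄ 2 = true  , false
fromℕ₄ _ = true  , true

fromℕ₄-toℕ₄ : ∀ x → fromℕ₄ (toℕ₄ x) ≡ x
fromℕ₄-toℕ₄ (false , false) = refl
fromℕ₄-toℕ₄ (false , true)  = refl
fromℕ₄-toℕ₄ (true  , false) = refl
fromℕ₄-toℕ₄ (true  , true)  = refl

toℕ₄-injective : ∀ {x y} → toℕ₄ x ≡ toℕ₄ y → x ≡ y
toℕ₄-injective {x} {y} eq = trans (sym (fromℕ₄-toℕ₄ x)) (trans (cong fromℕ₄ eq) (fromℕ₄-toℕ₄ y))

toℕ₄-fromℕ₄ : ∀ x {i} → i < toℕ₄ x → toℕ₄ (fromℕ₄ i) ≡ i
toℕ₄-fromℕ₄ _ {0} _ = refl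
toℕ₄-fromℕ₄ _ {1} _ = refl
toℕ₄-fromℕ₄ _ {2} _ = refl
toℕ₄-fromℕ₄ (false , false) {suc (suc (suc _))} ()
toℕ₄-fromℕ₄ (false , true)  {suc (suc (suc _))} (s≤s ())
toℕ₄-fromℕ₄ (true  , false) {suc (suc (suc _))} (s≤s (s≤s ()))
toℕ₄-fromℕ₄ (true  , true)  {suc (suc (suc _))} (s≤s (s≤s (s≤s ())))

⊕-assoc : ∀ x y z → x ⊕ y ⊕ z ≡ x ⊕ (y ⊕ z)
⊕-assoc x y z = cong₂ _,_ (xor-assoc (proj₁ x) _ _) (xor-assoc (proj₂ x) _ _)

⊕-comm : ∀ x y → x ⊕ y ≡ y ⊕ x
⊕-comm x y = cong₂ _,_ (xor-comm (proj₁ x) _) (xor-comm (proj₂ x) _)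

⊕-swapʳ : ∀ x y z → x ⊕ y ⊕ z ≡ x ⊕ z ⊕ y
⊕-swapʳ x y z = trans (⊕-assoc x y z) (trans (cong (x ⊕_) (⊕-comm y z)) (sym (⊕-assoc x z y)))

⊕-identityʳ : ∀ x → x ⊕ 0₄ ≡ x
⊕-identityʳ x = cong₂ _,_ (xor-identityʳ (proj₁ x)) (xor-identityʳ (proj₂ x))

⊕-self : ∀ x → x ⊕ x ≡ 0₄
⊕-self x = cong₂ _,_ (xor-same (proj₁ x)) (xor-same (proj₂ x))

⊕-cancelˡ : ∀ x y → x ⊕ (x ⊕ y) ≡ y
⊕-cancelˡ x y = trans (sym (⊕-assoc x x y)) (cong (_⊕ y) (⊕-self x))

⊕-injectiveʳ : ∀ x {y z} → x ⊕ y ≡ x ⊕ z → y ≡ z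
⊕-injectiveʳ x {y} {z} eq = trans (sym (⊕-cancelˡ x y)) (trans (cong (x ⊕_) eq) (⊕-cancelˡ x z))

⊕-injectiveˡ : ∀ {x y} z → x ⊕ z ≡ y ⊕ z → x ≡ y
⊕-injectiveˡ {x} {y} z eq = ⊕-injectiveʳ z (trans (⊕-comm z x) (trans eq (⊕-comm y z)))

succ₄ : Nim₄ → Nim₄
succ₄ (b₁ , b₀) = b₁ xor b₀ , not b₀

residue₄ : ℕ → Nim₄
residue₄ zero    = 0₄
residue₄ (suc k) = succ₄ (residue₄ k)

residue₄-periodic : ∀ k → residue₄ (4 + k) ≡ residue₄ k
residue₄-periodic k with residue₄ k
... | false , false = refl
... | false , true  = refl
... | true  , false = refl
... | true  , true  = refl

residue₄≡0⇔ : ∀ k → residue₄ k ≡ 0₄ ⇔ (3 + k) % 4 ≡ 3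
residue₄≡0⇔ 0 = mk⇔ (λ _ → refl) (λ _ → refl)
residue₄≡0⇔ 1 = mk⇔ (λ ()) (λ ())
residue₄≡0⇔ 2 = mk⇔ (λ ()) (λ ())
residue₄≡0⇔ 3 = mk⇔ (λ ()) (λ ())
residue₄≡0⇔ (suc (suc (suc (suc k)))) = mk⇔
  (λ eq → trans shift (Equivalence.to (residue₄≡0⇔ k) (trans (sym (residue₄-periodic k)) eq)))
  (λ eq → trans (residue₄-periodic k) (Equivalence.from (residue₄≡0⇔ k) (trans (sym shift) eq)))
  where
  shift : (3 + (4 + k)) % 4 ≡ (3 + k) % 4
  shift = trans (cong (λ j → (3 + j) % 4) (+-comm 4 k)) ([m+n]%n≡m%n (3 + k) 4)

residue₄-suc-≢ : ∀ k → residue₄ (suc k) ≢ residue₄ k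
residue₄-suc-≢ k eq = not-¬ refl (sym (cong proj₂ eq))

residue₄-2+-≢ : ∀ k → residue₄ (2 + k) ≢ residue₄ k
residue₄-2+-≢ k = succ₄²-≢ (residue₄ k)
  where
  succ₄²-≢ : ∀ x → succ₄ (succ₄ x) ≢ x
  succ₄²-≢ (false , false) ()
  succ₄²-≢ (false , true)  ()
  succ₄²-≢ (true  , false) ()
  succ₄²-≢ (true  , true)  ()

ones-residue₄-+ : ∀ a b → proj₂ (residue₄ (a + b)) ≡ proj₂ (residue₄ a) xor proj₂ (residue₄ b)
ones-residue₄-+ zero    b = refl
ones-residue₄-+ (suc a) b =
  trans (cong not (ones-residue₄-+ a b)) (not-distribˡ-xor (proj₂ (residue₄ a)) _)

-- The ones digit of residue₄ k is the parity of k, and a ⊕ b, a + b + 3 have different parities.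
residue₄-split : ∀ a b → residue₄ a ⊕ residue₄ b ≢ residue₄ (a + (3 + b))
residue₄-split a b eq = not-¬ refl (begin
  proj₂ (residue₄ a ⊕ residue₄ b)                  ≡⟨ cong proj₂ eq ⟩
  proj₂ (residue₄ (a + (3 + b)))                   ≡⟨ ones-residue₄-+ a (3 + b) ⟩
  ones-a xor not (not (not ones-b))                ≡⟨ cong (λ z → ones-a xor not z) (not-involutive ones-b) ⟩
  ones-a xor not ones-b                            ≡⟨ not-distribʳ-xor ones-a ones-b ⟨
  not (ones-a xor ones-b)                          ∎)
  where
  open ≡-Reasoning
  ones-a = proj₂ (residue₄ a)
  ones-b = proj₂ (residue₄ b)

-- The digit of x in the position of the leading digit of t (false if t = 0₄).
topDigit : Nim₄ → Nim₄ → Bool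
topDigit (true  , _)     x = proj₁ x
topDigit (false , true)  x = proj₂ x
topDigit (false , false) _ = false

topDigit-0₄ : ∀ t → T (topDigit t 0₄) → ⊥
topDigit-0₄ (true  , _)     ()
topDigit-0₄ (false , true)  ()
topDigit-0₄ (false , false) ()

topDigit-⊕ : ∀ t x y → topDigit t (x ⊕ y) ≡ topDigit t x xor topDigit t y
topDigit-⊕ (true  , _)     x y = refl
topDigit-⊕ (false , true)  x y = refl
topDigit-⊕ (false , false) x y = refl

topDigit-⊕-false : ∀ t {x y} → topDigit t x ≡ false → T (topDigit t (x ⊕ y)) → T (topDigit t y)
topDigit-⊕-false t {x} {y} top-x = subst T (trans (topDigit-⊕ t x y) (cong (_xor topDigit t y) top-x))

topDigit-below : ∀ x y → toℕ₄ y < toℕ₄ x → T (topDigit (x ⊕ y) x)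
topDigit-below (true  , _)     (false , _)     _ = _
topDigit-below (true  , true)  (true  , false) _ = _
topDigit-below (false , true)  (false , false) _ = _
topDigit-below (false , false) _               ()
topDigit-below (false , true)  (false , true)  y<x with () ← <⇒<ᵇ y<x
topDigit-below (false , true)  (true  , false) y<x with () ← <⇒<ᵇ y<x
topDigit-below (false , true)  (true  , true)  y<x with () ← <⇒<ᵇ y<x
topDigit-below (true  , false) (true  , false) y<x with () ← <⇒<ᵇ y<x
topDigit-below (true  , false) (true  , true)  y<x with () ← <⇒<ᵇ y<x
topDigit-below (true  , true)  (true  , true)  y<x with () ← <⇒<ᵇ y<x

residue₄-descend : ∀ k t → T (topDigit t (residue₄ k)) →
                   ∃₂ λ c k′ → c < 3 × k ≡ suc c + k′ × residue₄ k′ ≡ residue₄ k ⊕ t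
residue₄-descend 1 (false , true)  _ = 0 , 0 , s≤s z≤n , refl , refl
residue₄-descend 2 (true  , false) _ = 1 , 0 , s≤s (s≤s z≤n) , refl , refl
residue₄-descend 2 (true  , true)  _ = 0 , 1 , s≤s z≤n , refl , refl
residue₄-descend 3 (true  , false) _ = 1 , 1 , s≤s (s≤s z≤n) , refl , refl
residue₄-descend 3 (true  , true)  _ = 2 , 0 , s≤s (s≤s (s≤s z≤n)) , refl , refl
residue₄-descend 3 (false , true)  _ = 0 , 2 , s≤s z≤n , refl , refl
residue₄-descend (suc (suc (suc (suc k)))) t top
  with c , k′ , c<3 , k≡ , r≡ ← residue₄-descend k t (subst (T ∘ topDigit t) (residue₄-periodic k) top)
  = c , 4 + k′ , c<3 , trans (cong (4 +_) k≡) (x∙yz≈y∙xz 4 (suc c) k′) ,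
    trans (residue₄-periodic k′) (trans r≡ (cong (_⊕ t) (sym (residue₄-periodic k))))
residue₄-descend 0 (true  , _)     ()
residue₄-descend 0 (false , true)  ()
residue₄-descend 0 (false , false) ()
residue₄-descend 1 (true  , _)     ()
residue₄-descend 1 (false , false) ()
residue₄-descend 2 (false , true)  ()
residue₄-descend 2 (false , false) ()
residue₄-descend 3 (false , false) ()

-- Minimum excludant

∈⇒elem : ∀ {k xs} → k ∈ xs → T (elem k xs)
∈⇒elem {k} (here refl) = Equivalence.from T-∨ (inj₁ (≡⇒≡ᵇ k k refl))
∈⇒elem     (there k∈xs) = Equivalence.from T-∨ (inj₂ (∈⇒elem k∈xs))

elem⇒∈ : ∀ {k} xs → T (elem k xs) → k ∈ xs
elem⇒∈ {k} (x ∷ xs) h with Equivalence.to (T-∨ {k ≡ᵇ x}) h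
... | inj₁ k≡x = here (≡ᵇ⇒≡ k x k≡x)
... | inj₂ h′  = there (elem⇒∈ xs h′)

mexFrom-covers : ∀ f k xs {i} → k ≤ i → i < mexFrom f k xs → i ∈ xs
mexFrom-covers zero    k xs k≤i i<k = contradiction k≤i (<⇒≱ i<k)
mexFrom-covers (suc f) k xs k≤i i<m with elem k xs in k∈?xs
... | false = contradiction k≤i (<⇒≱ i<m)
... | true with m≤n⇒m<n∨m≡n k≤i
...   | inj₁ k<i  = mexFrom-covers f (suc k) xs k<i i<m
...   | inj₂ refl = elem⇒∈ xs (Equivalence.from T-≡ k∈?xs)

mexFrom-excludes : ∀ f k xs → mexFrom f k xs ∉ xs ⊎ mexFrom f k xs ≡ k + f
mexFrom-excludes zero    k xs = inj₂ (sym (+-identityʳ k))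
mexFrom-excludes (suc f) k xs with elem k xs in k∈?xs
... | false = inj₁ (λ k∈xs → subst T k∈?xs (∈⇒elem k∈xs))
... | true with mexFrom-excludes f (suc k) xs
...   | inj₁ ∉xs = inj₁ ∉xs
...   | inj₂ eq  = inj₂ (trans eq (sym (+-suc k f)))

covers⇒≤length : ∀ {m} xs → (∀ {i} → i < m → i ∈ xs) → m ≤ length xs
covers⇒≤length {m} xs covers with m ≤? length xs
... | yes m≤ = m≤
... | no m≰
  with i , j , i<j , same ← pigeonhole (≰⇒> m≰) (λ i → index (covers (toℕ<n i)))
  = contradiction (index-injective (setoid ℕ) (covers (toℕ<n i)) (covers (toℕ<n j)) same) (<⇒≢ i<j)

mex-covers : ∀ xs {i} → i < mex xs → i ∈ xs
mex-covers xs = mexFrom-covers (length xs) 0 xs z≤n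

-- The fuel length xs suffices because a list cannot contain length xs + 1 distinct numbers.
mex-∉ : ∀ xs → mex xs ∉ xs
mex-∉ xs with mexFrom-excludes (length xs) 0 xs
... | inj₁ ∉xs = ∉xs
... | inj₂ mex≡length = λ mex∈xs → <-irrefl mex≡length (covers⇒≤length xs (up-to-mex mex∈xs))
  where
  up-to-mex : mex xs ∈ xs → ∀ {i} → i < suc (mex xs) → i ∈ xs
  up-to-mex mex∈xs i≤mex with m≤n⇒m<n∨m≡n (s≤s⁻¹ i≤mex)
  ... | inj₁ i<mex = mex-covers xs i<mex
  ... | inj₂ refl  = mex∈xs

mex-unique : ∀ {m} xs → (∀ {i} → i < m → i ∈ xs) → m ∉ xs → mex xs ≡ m
mex-unique {m} xs covers m∉xs with <-cmp (mex xs) m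
... | tri< mex<m _ _ = contradiction (covers mex<m) (mex-∉ xs)
... | tri≈ _ eq _    = eq
... | tri> _ _ m<mex = contradiction (mex-covers xs m<mex) m∉xs

mex-cong : ∀ xs ys → xs ⊆ ys → ys ⊆ xs → mex xs ≡ mex ys
mex-cong xs ys xs⊆ys ys⊆xs = sym (mex-unique ys (xs⊆ys ∘ mex-covers xs) (mex-∉ xs ∘ ys⊆xs))

any-≡ᵇ0 : ∀ xs → any (_≡ᵇ 0) xs ≡ not (mex xs ≡ᵇ 0)
any-≡ᵇ0 xs with mex xs | mex-covers xs | mex-∉ xs
... | zero  | _      | 0∉xs =
  ¬-not (λ any≡ → 0∉xs (Any.map (λ {x} x≡0 → sym (≡ᵇ⇒≡ x 0 x≡0)) (any⁻ _ xs (Equivalence.from T-≡ any≡))))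
... | suc _ | covers | _    = Equivalence.to T-≡ (any⁺ _ (Any.map (λ { refl → _ }) (covers (s≤s z≤n))))

-- The domination game on a graph

-- `moves` filters with a function local to its definition; unification gives it a name here.
movesFilter : ∀ {n} → Graph n → Position n → (Fin n → Bool) → List (Fin n) → List (Fin n)
moves-unfold : ∀ {n} (G : Graph n) D → moves G D ≡ movesFilter G D (playable G D) (allFin n)

movesFilter = _
moves-unfold {n} G D with playable G D
... | p with allFin n
... | l = refl

movesFilter≡filterᵇ : ∀ {n} (G : Graph n) D p xs → movesFilter G D p xs ≡ filterᵇ p xs
movesFilter≡filterᵇ G D p []       = refl
movesFilter≡filterᵇ G D p (x ∷ xs) with p x
... | true  = cong (x ∷_) (movesFilter≡filterᵇ G D p xs)
... | false = movesFilter≡filterᵇ G D p xs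

moves≡filterᵇ : ∀ {n} (G : Graph n) D → moves G D ≡ filterᵇ (playable G D) (allFin n)
moves≡filterᵇ {n} G D = trans (moves-unfold G D) (movesFilter≡filterᵇ G D (playable G D) (allFin n))

∈-moves⁺ : ∀ {n} (G : Graph n) D {v} → T (playable G D v) → v ∈ moves G D
∈-moves⁺ G D {v} pv = subst (v ∈_) (sym (moves≡filterᵇ G D)) (∈-filter⁺ (T? ∘ playable G D) (∈-allFin v) pv)

∈-moves⁻ : ∀ {n} (G : Graph n) D {v} → v ∈ moves G D → T (playable G D v)
∈-moves⁻ G D {v} v∈ =
  proj₂ (∈-filter⁻ (T? ∘ playable G D) {xs = allFin _} (subst (v ∈_) (moves≡filterᵇ G D) v∈))

module _ {n} (G : Graph n) (D : Position n) (v : Fin n) where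

  private
    newlyDominated : Fin n → Bool
    newlyDominated u = dominates G v u ∧ not (D u)

  playable⁺ : ∀ u → T (dominates G v u) → D u ≡ false → T (playable G D v)
  playable⁺ u dom und = Equivalence.to (any⇔ {xs = allFin n} {p = newlyDominated})
    (lose (∈-allFin u) (Equivalence.from T-∧ (dom , Equivalence.from T-not-≡ und)))

  playable⁻ : T (playable G D v) → ∃ λ u → T (dominates G v u) × D u ≡ false
  playable⁻ pv with u , du ← satisfied (Equivalence.from (any⇔ {xs = allFin n} {p = newlyDominated}) pv)
    = u , proj₁ (Equivalence.to T-∧ du) , Equivalence.to T-not-≡ (proj₂ (Equivalence.to T-∧ du))

winsB≡nimberB≢0 : ∀ {n} f (G : Graph n) D → winsB f G D ≡ not (nimberB f G D ≡ᵇ 0)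
winsB≡nimberB≢0 zero    G D = refl
winsB≡nimberB≢0 (suc f) G D = begin
  any (λ v → not (winsB f G (play G D v))) (moves G D)  ≡⟨ cong or (map-cong losing⇔zero (moves G D)) ⟩
  any ((_≡ᵇ 0) ∘ value) (moves G D)                     ≡⟨ cong or (map-∘ (moves G D)) ⟩
  any (_≡ᵇ 0) (map value (moves G D))                   ≡⟨ any-≡ᵇ0 (map value (moves G D)) ⟩
  not (nimberB (suc f) G D ≡ᵇ 0)                        ∎
  where
  open ≡-Reasoning
  value : Fin _ → ℕ
  value v = nimberB f G (play G D v)
  losing⇔zero : ∀ v → not (winsB f G (play G D v)) ≡ (value v ≡ᵇ 0)
  losing⇔zero v = trans (cong not (winsB≡nimberB≢0 f G (play G D v))) (not-involutive _)

module Automorphism {n} (G : Graph n) (σ : Fin n → Fin n)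
  (σ-dominates : ∀ v u → dominates G (σ v) (σ u) ≡ dominates G v u)
  (σ-surjective : ∀ w → ∃ λ v → σ v ≡ w) where

  playable-σ : ∀ {D D′} → (∀ u → D′ u ≡ D (σ u)) → ∀ v → T (playable G D′ v) → T (playable G D (σ v))
  playable-σ {D} {D′} D′≡ v pv with u , dom , und ← playable⁻ G D′ v pv =
    playable⁺ G D (σ v) (σ u) (subst T (sym (σ-dominates v u)) dom) (trans (sym (D′≡ u)) und)

  playable-σ⁻ : ∀ {D D′} → (∀ u → D′ u ≡ D (σ u)) → ∀ v → T (playable G D (σ v)) → T (playable G D′ v)
  playable-σ⁻ {D} {D′} D′≡ v pv with w , dom , und ← playable⁻ G D (σ v) pv | σ-surjective w
  ... | u , refl = playable⁺ G D′ v u (subst T (σ-dominates v u) dom) (trans (D′≡ u) und)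

  nimberB-σ : ∀ f {D D′} → (∀ u → D′ u ≡ D (σ u)) → nimberB f G D′ ≡ nimberB f G D
  nimberB-σ zero    D′≡ = refl
  nimberB-σ (suc f) {D} {D′} D′≡ = mex-cong (map value′ (moves G D′)) (map value (moves G D)) forth back
    where
    value value′ : Fin n → ℕ
    value  w = nimberB f G (play G D w)
    value′ v = nimberB f G (play G D′ v)
    value′≡ : ∀ v → value′ v ≡ value (σ v)
    value′≡ v = nimberB-σ f λ u → cong₂ _∨_ (D′≡ u) (sym (σ-dominates v u))
    forth : map value′ (moves G D′) ⊆ map value (moves G D)
    forth i∈ with v , v∈ , refl ← ∈-map⁻ value′ i∈ = subst (_∈ map value (moves G D)) (sym (value′≡ v))
      (∈-map⁺ value (∈-moves⁺ G D (playable-σ D′≡ v (∈-moves⁻ G D′ v∈))))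
    back : map value (moves G D) ⊆ map value′ (moves G D′)
    back i∈ with w , w∈ , refl ← ∈-map⁻ value i∈ | σ-surjective w
    ... | v , refl = subst (_∈ map value′ (moves G D′)) (value′≡ v)
      (∈-map⁺ value′ (∈-moves⁺ G D′ (playable-σ⁻ D′≡ v (∈-moves⁻ G D w∈))))

module GrundyCharacterisation {n} (G : Graph n) (Good : Position n → Set) (size value : Position n → ℕ)
  (good-play  : ∀ {D v} → Good D → T (playable G D v) → Good (play G D v))
  (size-play  : ∀ {D v} → Good D → T (playable G D v) → size (play G D v) < size D)
  (value-play : ∀ {D v} → Good D → T (playable G D v) → value (play G D v) ≢ value D)
  (value-reach : ∀ {D i} → Good D → i < value D → ∃ λ v → T (playable G D v) × value (play G D v) ≡ i)
  where

  nimberB≡value : ∀ f {D} → Good D → size D ≤ f → nimberB f G D ≡ value D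
  nimberB≡value zero {D} good size≤0 with value D in value≡
  ... | zero  = refl
  ... | suc _ with v , pv , _ ← value-reach good (subst (0 <_) (sym value≡) (s≤s z≤n))
    = contradiction (≤-trans (size-play good pv) size≤0) n≮0
  nimberB≡value (suc f) {D} good size≤ =
    mex-unique (map value′ (moves G D)) covered (λ v∈ → excluded (∈-map⁻ value′ v∈))
    where
    value′ : Fin n → ℕ
    value′ v = nimberB f G (play G D v)
    value′≡ : ∀ {v} → T (playable G D v) → value′ v ≡ value (play G D v)
    value′≡ pv = nimberB≡value f (good-play good pv) (≤-pred (≤-trans (size-play good pv) size≤))
    covered : ∀ {i} → i < value D → i ∈ map value′ (moves G D)
    covered i< with v , pv , refl ← value-reach good i< =
      subst (_∈ map value′ (moves G D)) (value′≡ pv) (∈-map⁺ value′ (∈-moves⁺ G D pv))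
    excluded : (∃ λ v → v ∈ moves G D × value D ≡ value′ v) → ⊥
    excluded (v , v∈ , eq) = value-play good pv (sym (trans eq (value′≡ pv)))
      where pv = ∈-moves⁻ G D v∈

module _ {n} (G : Graph n) (D : Position n) f (c : ℕ)
  (all-moves-to-c : ∀ v → T (playable G D v) → nimberB f G (play G D v) ≡ c) where

  private
    options : List ℕ
    options = map (λ v → nimberB f G (play G D v)) (moves G D)

    options≡c : ∀ {i} → i ∈ options → i ≡ c
    options≡c i∈ with v , v∈ , refl ← ∈-map⁻ _ i∈ = all-moves-to-c v (∈-moves⁻ G D v∈)

  nimberB-moves-to-0 : ∀ v → T (playable G D v) → c ≡ 0 → nimberB (suc f) G D ≡ 1
  nimberB-moves-to-0 v pv refl = mex-unique options
    (λ { (s≤s z≤n) → subst (_∈ options) (all-moves-to-c v pv) (∈-map⁺ _ (∈-moves⁺ G D pv)) })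
    (λ 1∈ → contradiction (options≡c 1∈) λ ())

  nimberB-moves-to-nonzero : c ≢ 0 → nimberB (suc f) G D ≡ 0
  nimberB-moves-to-nonzero c≢0 = mex-unique options (λ ()) (λ 0∈ → c≢0 (sym (options≡c 0∈)))

playerToMoveWins⇔ : ∀ {n} (G : Graph n) D → playerToMoveWins G D ≡ true ⇔ nimber G D ≢ 0
playerToMoveWins⇔ {n} G D rewrite winsB≡nimberB≢0 (suc n) G D with nimber G D
... | zero  = mk⇔ (λ ()) (λ 0≢0 → contradiction refl 0≢0)
... | suc _ = mk⇔ (λ _ ()) (λ _ → refl)

-- Words: a path of vertices in order, true marking a dominated vertex

gap : ℕ → List Bool
gap k = replicate k false

-- Selecting the vertex at position c + 1 dominates positions c, c + 1 and c + 2.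
playAt : ℕ → List Bool → List Bool
playAt zero    (_ ∷ _ ∷ _ ∷ w) = true ∷ true ∷ true ∷ w
playAt zero    w               = w
playAt (suc c) []              = []
playAt (suc c) (b ∷ w)         = b ∷ playAt c w

playableAt : ℕ → List Bool → Bool
playableAt zero    (a ∷ b ∷ d ∷ _) = not (a ∧ b ∧ d)
playableAt zero    _               = false
playableAt (suc c) []              = false
playableAt (suc c) (_ ∷ w)         = playableAt c w

undominated : List Bool → ℕ
undominated []          = 0
undominated (false ∷ w) = suc (undominated w)
undominated (true ∷ w)  = undominated w

-- The nim-sum of the lengths mod 4 of the maximal undominated runs; k is the length of the run being read.
runNimberFrom : ℕ → List Bool → Nim₄
runNimberFrom k []          = residue₄ k
runNimberFrom k (false ∷ w) = runNimberFrom (suc k) w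
runNimberFrom k (true ∷ w)  = residue₄ k ⊕ runNimberFrom 0 w

runNimber : List Bool → Nim₄
runNimber = runNimberFrom 0

-- Every undominated run has at least two dominated vertices on each side, so no vertex reaches
-- into two runs.
data Separated : List Bool → Set where
  end  : Separated (true ∷ true ∷ [])
  dom∷ : ∀ {w} → Separated w → Separated (true ∷ w)
  gap∷ : ∀ {w} k → Separated w → Separated (true ∷ true ∷ gap k ++ w)

Separated-head : ∀ {w} → Separated w → ∃ λ e → w ≡ true ∷ true ∷ e
Separated-head end        = [] , refl
Separated-head (dom∷ s) with e , refl ← Separated-head s = true ∷ e , refl
Separated-head (gap∷ k s) = _ , refl

playAt-gap : ∀ k c w → playAt (k + c) (gap k ++ w) ≡ gap k ++ playAt c w
playAt-gap zero    c w = refl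
playAt-gap (suc k) c w = cong (false ∷_) (playAt-gap k c w)

playableAt-gap : ∀ k c w → playableAt (k + c) (gap k ++ w) ≡ playableAt c w
playableAt-gap zero    c w = refl
playableAt-gap (suc k) c w = playableAt-gap k c w

runNimberFrom-gap : ∀ j k w → runNimberFrom k (gap j ++ w) ≡ runNimberFrom (j + k) w
runNimberFrom-gap zero    k w = refl
runNimberFrom-gap (suc j) k w = trans (runNimberFrom-gap j (suc k) w) (cong (λ i → runNimberFrom i w) (+-suc j k))

runNimber-gap : ∀ k w → runNimber (gap k ++ true ∷ w) ≡ residue₄ k ⊕ runNimber w
runNimber-gap k w = trans (runNimberFrom-gap k 0 (true ∷ w)) (cong (λ i → residue₄ i ⊕ runNimber w) (+-identityʳ k))

undominated-∷ : ∀ b w → undominated w ≤ undominated (b ∷ w)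
undominated-∷ true  w = ≤-refl
undominated-∷ false w = n≤1+n _

playAt-undominated< : ∀ c w → T (playableAt c w) → undominated (playAt c w) < undominated w
playAt-undominated< zero    (true ∷ true ∷ false ∷ w) _ = ≤-refl
playAt-undominated< zero    (true ∷ false ∷ d ∷ w)    _ = s≤s (undominated-∷ d w)
playAt-undominated< zero    (false ∷ b ∷ d ∷ w)       _ = s≤s (≤-trans (undominated-∷ d w) (undominated-∷ b (d ∷ w)))
playAt-undominated< (suc c) (true ∷ w)  p = playAt-undominated< c w p
playAt-undominated< (suc c) (false ∷ w) p = s≤s (playAt-undominated< c w p)

playAt-inside : ∀ j m u → playAt j (gap (j + suc m) ++ u) ≡ gap j ++ playAt 0 (false ∷ gap m ++ u)
playAt-inside zero    m u = refl
playAt-inside (suc j) m u = cong (false ∷_) (playAt-inside j m u)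

runNimber-gap≡ : ∀ j k w w′ → runNimber (gap j ++ true ∷ w) ≡ runNimber (gap k ++ true ∷ w′) →
                 residue₄ j ⊕ runNimber w ≡ residue₄ k ⊕ runNimber w′
runNimber-gap≡ j k w w′ eq = trans (sym (runNimber-gap j w)) (trans eq (runNimber-gap k w′))

runNimber-gap-≢ : ∀ j k w w′ → runNimber w ≡ runNimber w′ → residue₄ j ≢ residue₄ k →
                  runNimber (gap j ++ true ∷ w) ≢ runNimber (gap k ++ true ∷ w′)
runNimber-gap-≢ j k w w′ same r≢ eq =
  r≢ (⊕-injectiveˡ (runNimber w) (trans (runNimber-gap≡ j k w w′ eq) (cong (residue₄ k ⊕_) (sym same))))

runNimber-after-gap : ∀ k {w} → Separated w → runNimber (gap k ++ w) ≡ residue₄ k ⊕ runNimber w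
runNimber-after-gap k s with _ , refl ← Separated-head s = runNimber-gap k _

runNimber-shorten : ∀ k k′ t {w} → residue₄ k′ ≡ residue₄ k ⊕ t →
                    runNimber (gap k′ ++ true ∷ w) ≡ runNimber (gap k ++ true ∷ w) ⊕ t
runNimber-shorten k k′ t {w} r≡ = begin
  runNimber (gap k′ ++ true ∷ w)      ≡⟨ runNimber-gap k′ w ⟩
  residue₄ k′ ⊕ runNimber w           ≡⟨ cong (_⊕ runNimber w) r≡ ⟩
  residue₄ k ⊕ t ⊕ runNimber w        ≡⟨ ⊕-swapʳ (residue₄ k) t _ ⟩
  residue₄ k ⊕ runNimber w ⊕ t        ≡⟨ cong (_⊕ t) (runNimber-gap k w) ⟨
  runNimber (gap k ++ true ∷ w) ⊕ t   ∎
  where open ≡-Reasoning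

inside-or-beyond : ∀ j k → (∃ λ m → k ≡ j + suc m) ⊎ (∃ λ d → j ≡ k + d)
inside-or-beyond j       zero    = inj₂ (j , refl)
inside-or-beyond zero    (suc k) = inj₁ (k , refl)
inside-or-beyond (suc j) (suc k) with inside-or-beyond j k
... | inj₁ (m , refl) = inj₁ (m , refl)
... | inj₂ (d , refl) = inj₂ (d , refl)

Outcome : ℕ → List Bool → Set
Outcome c w = Separated (playAt c w) × runNimber (playAt c w) ≢ runNimber w

outcome-∷∷ : ∀ c w {x} → playAt c w ≡ x → Separated (true ∷ true ∷ x) × runNimber x ≢ runNimber w →
             Outcome (2 + c) (true ∷ true ∷ w)
outcome-∷∷ _ _ refl outcome = outcome

playAt-separated : ∀ {w} → Separated w → ∀ c → T (playableAt c w) → Outcome c w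
playAt-in-gap    : ∀ k {e} → Separated (true ∷ true ∷ e) → ∀ c →
                   T (playableAt c (true ∷ true ∷ gap k ++ true ∷ true ∷ e)) →
                   Outcome c (true ∷ true ∷ gap k ++ true ∷ true ∷ e)

playAt-separated end 0                   ()
playAt-separated end 1                   ()
playAt-separated end 2                   ()
playAt-separated end (suc (suc (suc _))) ()
playAt-separated (dom∷ s) c p with Separated-head s
playAt-separated (dom∷ s) zero    () | _ , refl
playAt-separated (dom∷ s) (suc c) p  | _ , refl with s′ , changed ← playAt-separated s c p = dom∷ s′ , changed
playAt-separated (gap∷ k s) c p with Separated-head s
... | _ , refl = playAt-in-gap k s c p

-- Windows 0 and 1 cut one or two vertices off the left end of the gap; window j + 2 either starts
-- inside the gap, cutting off its right end or splitting it in two, or lies beyond it.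
playAt-in-gap (suc k) s 0 _ =
  dom∷ (gap∷ k s) , runNimber-gap-≢ k (suc k) _ _ refl (≢-sym (residue₄-suc-≢ k))
playAt-in-gap 1 {e} s 1 _ =
  dom∷ (dom∷ (dom∷ s)) ,
  runNimber-gap-≢ 0 1 (true ∷ true ∷ true ∷ true ∷ e) (true ∷ e) refl (≢-sym (residue₄-suc-≢ 0))
playAt-in-gap (suc (suc k)) s 1 _ =
  dom∷ (dom∷ (gap∷ k s)) , runNimber-gap-≢ k (2 + k) _ _ refl (≢-sym (residue₄-2+-≢ k))
playAt-in-gap k {e} s (suc (suc j)) p with inside-or-beyond j k
... | inj₁ (m , refl) = outcome-∷∷ j (gap (j + suc m) ++ u) (playAt-inside j m u) (inside m)
  where
  u : List Bool
  u = true ∷ true ∷ e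
  inside : ∀ m → let w′ = gap j ++ playAt 0 (false ∷ gap m ++ u) in
                 Separated (true ∷ true ∷ w′) × runNimber w′ ≢ runNimber (gap (j + suc m) ++ u)
  inside 0 = gap∷ j (dom∷ s) ,
    runNimber-gap-≢ j (j + 1) u (true ∷ e) refl
      λ eq → residue₄-suc-≢ j (trans (cong residue₄ (+-comm 1 j)) (sym eq))
  inside 1 = gap∷ j (dom∷ (dom∷ s)) ,
    runNimber-gap-≢ j (j + 2) (true ∷ u) (true ∷ e) refl
      λ eq → residue₄-2+-≢ j (trans (cong residue₄ (+-comm 2 j)) (sym eq))
  inside (suc (suc r)) = gap∷ j (dom∷ (gap∷ r s)) ,
    λ eq → residue₄-split j r (⊕-injectiveˡ (runNimber e) (begin
    residue₄ j ⊕ residue₄ r ⊕ runNimber e                 ≡⟨ ⊕-assoc (residue₄ j) _ _ ⟩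
    residue₄ j ⊕ (residue₄ r ⊕ runNimber e)               ≡⟨ cong (residue₄ j ⊕_) (runNimber-gap r (true ∷ e)) ⟨
    residue₄ j ⊕ runNimber (true ∷ true ∷ gap r ++ u)     ≡⟨ runNimber-gap≡ j (j + (3 + r)) _ (true ∷ e) eq ⟩
    residue₄ (j + (3 + r)) ⊕ runNimber e                  ∎))
    where open ≡-Reasoning
... | inj₂ (d , refl) with s′ , changed ← playAt-separated s d (subst T (playableAt-gap k d _) p) =
  outcome-∷∷ (k + d) (gap k ++ true ∷ true ∷ e) (playAt-gap k d _) (gap∷ k s′ , λ eq →
    changed (⊕-injectiveʳ (residue₄ k) (trans (sym (runNimber-after-gap k s′)) (trans eq (runNimber-after-gap k s)))))

playAt-reaches        : ∀ {w} → Separated w → ∀ t → T (topDigit t (runNimber w)) →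
                        ∃ λ c → T (playableAt c w) × runNimber (playAt c w) ≡ runNimber w ⊕ t
playAt-reaches-in-gap : ∀ k {e} → Separated (true ∷ true ∷ e) → ∀ t →
                        let w = true ∷ true ∷ gap k ++ true ∷ true ∷ e in T (topDigit t (runNimber w)) →
                        ∃ λ c → T (playableAt c w) × runNimber (playAt c w) ≡ runNimber w ⊕ t

playAt-reaches end        t top = ⊥-elim (topDigit-0₄ t top)
playAt-reaches (dom∷ s)   t top with c , p , eq ← playAt-reaches s t top = suc c , p , eq
playAt-reaches (gap∷ k s) t top with Separated-head s
... | _ , refl = playAt-reaches-in-gap k s t top

playAt-reaches-in-gap k {e} s t top with topDigit t (residue₄ k) in top-k
... | true with c , k′ , c<3 , refl , r≡ ← residue₄-descend k t (Equivalence.from T-≡ top-k) with c<3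
...   | s≤s z≤n             = 0 , _ , runNimber-shorten (1 + k′) k′ t r≡
...   | s≤s (s≤s z≤n)       = 1 , _ , runNimber-shorten (2 + k′) k′ t r≡
...   | s≤s (s≤s (s≤s z≤n)) = 2 , _ , runNimber-shorten (3 + k′) k′ t r≡
playAt-reaches-in-gap k {e} s t top | false
  with d , p , eq ← playAt-reaches s t
                     (topDigit-⊕-false t top-k (subst (T ∘ topDigit t) (runNimber-gap k (true ∷ e)) top)) =
  2 + (k + d) , subst T (sym (playableAt-gap k d _)) p , (begin
    runNimber (playAt (k + d) (gap k ++ u))   ≡⟨ cong runNimber (playAt-gap k d u) ⟩
    runNimber (gap k ++ playAt d u)           ≡⟨ runNimber-after-gap k (proj₁ (playAt-separated s d p)) ⟩
    residue₄ k ⊕ runNimber (playAt d u)       ≡⟨ cong (residue₄ k ⊕_) eq ⟩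
    residue₄ k ⊕ (runNimber u ⊕ t)            ≡⟨ ⊕-assoc (residue₄ k) _ t ⟨
    residue₄ k ⊕ runNimber u ⊕ t              ≡⟨ cong (_⊕ t) (runNimber-after-gap k s) ⟨
    runNimber (gap k ++ u) ⊕ t                ∎)
  where
  open ≡-Reasoning
  u : List Bool
  u = true ∷ true ∷ e

at : List Bool → ℕ → Bool
at []      _       = false
at (b ∷ _) zero    = b
at (_ ∷ w) (suc i) = at w i

at-extensionality : ∀ w w′ → length w ≡ length w′ → (∀ i → i < length w → at w i ≡ at w′ i) → w ≡ w′
at-extensionality []      []        _   _    = refl
at-extensionality (b ∷ w) (b′ ∷ w′) len same =
  cong₂ _∷_ (same 0 (s≤s z≤n)) (at-extensionality w w′ (suc-injective len) (λ i i< → same (suc i) (s≤s i<)))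

inWindow : ℕ → ℕ → Bool
inWindow zero    i       = i ≤ᵇ 2
inWindow (suc c) zero    = false
inWindow (suc c) (suc i) = inWindow c i

inWindow-≤ : ∀ c i → T (inWindow c i) → i ≤ 2 + c
inWindow-≤ zero    0       _ = z≤n
inWindow-≤ zero    1       _ = s≤s z≤n
inWindow-≤ zero    2       _ = s≤s (s≤s z≤n)
inWindow-≤ (suc c) (suc i) p = s≤s (inWindow-≤ c i p)

length-playAt : ∀ c w → length (playAt c w) ≡ length w
length-playAt zero    []              = refl
length-playAt zero    (_ ∷ [])        = refl
length-playAt zero    (_ ∷ _ ∷ [])    = refl
length-playAt zero    (_ ∷ _ ∷ _ ∷ _) = refl
length-playAt (suc c) []              = refl
length-playAt (suc c) (_ ∷ w)         = cong suc (length-playAt c w)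

at-playAt : ∀ c w i → 2 + c < length w → at (playAt c w) i ≡ at w i ∨ inWindow c i
at-playAt zero    (a ∷ _ ∷ _ ∷ _) 0 _ = sym (∨-zeroʳ a)
at-playAt zero    (_ ∷ b ∷ _ ∷ _) 1 _ = sym (∨-zeroʳ b)
at-playAt zero    (_ ∷ _ ∷ d ∷ _) 2 _ = sym (∨-zeroʳ d)
at-playAt zero    (_ ∷ _ ∷ _ ∷ w) (suc (suc (suc i))) _ = sym (∨-identityʳ (at w i))
at-playAt zero    (_ ∷ [])        _ (s≤s ())
at-playAt zero    (_ ∷ _ ∷ [])    _ (s≤s (s≤s ()))
at-playAt (suc c) (b ∷ _) zero    _ = sym (∨-identityʳ b)
at-playAt (suc c) (_ ∷ w) (suc i) (s≤s c<) = at-playAt c w i c<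

playableAt⁺ : ∀ c w i → 2 + c < length w → T (inWindow c i) → at w i ≡ false → T (playableAt c w)
playableAt⁺ zero    (false ∷ _ ∷ _ ∷ _)         0 _ _ refl = _
playableAt⁺ zero    (true ∷ false ∷ _ ∷ _)      1 _ _ refl = _
playableAt⁺ zero    (false ∷ _ ∷ _ ∷ _)         1 _ _ refl = _
playableAt⁺ zero    (true ∷ true ∷ false ∷ _)   2 _ _ refl = _
playableAt⁺ zero    (true ∷ false ∷ _ ∷ _)      2 _ _ refl = _
playableAt⁺ zero    (false ∷ _ ∷ _ ∷ _)         2 _ _ refl = _
playableAt⁺ zero    (_ ∷ [])                    _ (s≤s ()) _ _
playableAt⁺ zero    (_ ∷ _ ∷ [])                _ (s≤s (s≤s ())) _ _
playableAt⁺ (suc c) (_ ∷ w) (suc i) (s≤s c<) p und = playableAt⁺ c w i c< p und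

playableAt⁻ : ∀ c w → T (playableAt c w) → 2 + c < length w × ∃ λ i → T (inWindow c i) × at w i ≡ false
playableAt⁻ zero    (false ∷ _ ∷ _ ∷ _)       _ = s≤s (s≤s (s≤s z≤n)) , 0 , _ , refl
playableAt⁻ zero    (true ∷ false ∷ _ ∷ _)    _ = s≤s (s≤s (s≤s z≤n)) , 1 , _ , refl
playableAt⁻ zero    (true ∷ true ∷ false ∷ _) _ = s≤s (s≤s (s≤s z≤n)) , 2 , _ , refl
playableAt⁻ (suc c) (_ ∷ w) p with c< , i , inW , und ← playableAt⁻ c w p = s≤s c< , suc i , inW , und

at-tabulate-++ : ∀ {k} (f : Fin k → Bool) ys {j} (j<k : j < k) → at (tabulate f ++ ys) j ≡ f (fromℕ< j<k)
at-tabulate-++ {suc k} f ys {zero}  _          = refl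
at-tabulate-++ {suc k} f ys {suc j} (s≤s j<k) = at-tabulate-++ (f ∘ suc) ys j<k

at-tabulate-++-end : ∀ {k} (f : Fin k → Bool) ys → at (tabulate f ++ ys) k ≡ at ys 0
at-tabulate-++-end {zero}  f ys = refl
at-tabulate-++-end {suc k} f ys = at-tabulate-++-end (f ∘ suc) ys

at-gap-< : ∀ {k i} w → i < k → at (gap k ++ w) i ≡ false
at-gap-< {suc k} {zero}  w _         = refl
at-gap-< {suc k} {suc i} w (s≤s i<k) = at-gap-< w i<k

at-gap-+ : ∀ k w i → at (gap k ++ w) (k + i) ≡ at w i
at-gap-+ zero    w i = refl
at-gap-+ (suc k) w i = at-gap-+ k w i

undominated-gap : ∀ k w → undominated (gap k ++ w) ≡ k + undominated w
undominated-gap zero    w = refl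
undominated-gap (suc k) w = cong suc (undominated-gap k w)

-- The cycle

≡ᵇ-cong⇔ : ∀ {a b c d} → (a ≡ b → c ≡ d) → (c ≡ d → a ≡ b) → (a ≡ᵇ b) ≡ (c ≡ᵇ d)
≡ᵇ-cong⇔ {a} {b} {c} {d} to from = ⇔→≡ {z = true} (mk⇔
  (λ e → Equivalence.to T-≡ (≡⇒≡ᵇ c d (to (≡ᵇ⇒≡ a b (Equivalence.from T-≡ e)))))
  (λ e → Equivalence.to T-≡ (≡⇒≡ᵇ a b (from (≡ᵇ⇒≡ c d (Equivalence.from T-≡ e))))))

∨-cong-false : ∀ a {b c} → (a ≡ false → b ≡ c) → a ∨ b ≡ a ∨ c
∨-cong-false true  _ = refl
∨-cong-false false f = f refl

module Cycle (m : ℕ) where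

  n : ℕ
  n = suc m

  next : ℕ → ℕ
  next x = suc x % n

  next-< : ∀ {x} → x < m → next x ≡ suc x
  next-< x<m = m<n⇒m%n≡m (s≤s x<m)

  next-last : next m ≡ 0
  next-last = n%n≡0 n

  next<n : ∀ x → next x < n
  next<n x = m%n<n (suc x) n

  next-injective : ∀ {x y} → x < n → y < n → next x ≡ next y → x ≡ y
  next-injective {x} {y} x<n y<n eq with m≤n⇒m<n∨m≡n (s≤s⁻¹ x<n) | m≤n⇒m<n∨m≡n (s≤s⁻¹ y<n)
  ... | inj₁ x<m  | inj₁ y<m  = suc-injective (trans (sym (next-< x<m)) (trans eq (next-< y<m)))
  ... | inj₁ x<m  | inj₂ refl = contradiction (trans (sym (next-< x<m)) (trans eq next-last)) λ ()
  ... | inj₂ refl | inj₁ y<m  = contradiction (trans (sym (next-< y<m)) (trans (sym eq) next-last)) λ ()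
  ... | inj₂ refl | inj₂ refl = refl

  -- `dominates (cycle n) v u` unfolds to `dominatesℕ (toℕ v) (toℕ u)`.
  dominatesℕ : ℕ → ℕ → Bool
  dominatesℕ a b = (a ≡ᵇ b) ∨ ((next a ≡ᵇ b) ∨ (next b ≡ᵇ a))

  dominatesℕ-next : ∀ {a b} → a < n → b < n → dominatesℕ (next a) (next b) ≡ dominatesℕ a b
  dominatesℕ-next {a} {b} a<n b<n =
    cong₂ _∨_ (≡ᵇ-next a<n b<n) (cong₂ _∨_ (≡ᵇ-next (next<n a) b<n) (≡ᵇ-next (next<n b) a<n))
    where
    ≡ᵇ-next : ∀ {x y} → x < n → y < n → (next x ≡ᵇ next y) ≡ (x ≡ᵇ y)
    ≡ᵇ-next x<n y<n = ≡ᵇ-cong⇔ (next-injective x<n y<n) (cong next)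

  window : ∀ a j → (a ≡ᵇ j) ∨ ((suc a ≡ᵇ j) ∨ (suc j ≡ᵇ a)) ≡ inWindow a (suc j)
  window zero          zero          = refl
  window zero          (suc zero)    = refl
  window zero          (suc (suc j)) = refl
  window (suc zero)    zero          = refl
  window (suc (suc a)) zero          = refl
  window (suc a)       (suc j)       = window a j

  dominatesℕ-interior : ∀ {a j} → a < n → 1 ≤ j → j < m → dominatesℕ a j ≡ inWindow a (suc j)
  dominatesℕ-interior {a} {j} a<n 1≤j j<m =
    trans (cong₂ (λ x y → (a ≡ᵇ j) ∨ (x ∨ (y ≡ᵇ a))) next-a (next-< j<m)) (window a j)
    where
    next-a : (next a ≡ᵇ j) ≡ (suc a ≡ᵇ j)
    next-a with m≤n⇒m<n∨m≡n (s≤s⁻¹ a<n)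
    ... | inj₁ a<m  = cong (_≡ᵇ j) (next-< a<m)
    ... | inj₂ refl = ≡ᵇ-cong⇔ {next m} {j} {suc m} {j}
      (λ e → contradiction (subst (1 ≤_) (trans (sym e) next-last) 1≤j) λ ())
      (λ e → contradiction (≤-trans (n≤1+n _) (subst (_< m) (sym e) j<m)) 1+n≰n)

  G : Graph n
  G = cycle n

  last : Fin n
  last = fromℕ m

  -- The cycle cut open at vertex 0, with a copy of vertex m in front and of vertex 0 at the back.
  unroll : Position n → List Bool
  unroll D = D last ∷ tabulate D ++ D zero ∷ []

  length-unroll : ∀ D → length (unroll D) ≡ 2 + n
  length-unroll D = cong suc (trans (length-++ (tabulate D)) (trans (cong (_+ 1) (length-tabulate D)) (+-comm n 1)))

  data Slot : ℕ → Set where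
    front  : Slot 0
    vertex : (u : Fin n) → Slot (suc (toℕ u))
    back   : Slot (suc n)

  slot : ∀ {i} → i < 2 + n → Slot i
  slot {zero}  _   = front
  slot {suc j} j<  with m≤n⇒m<n∨m≡n (s≤s⁻¹ (s≤s⁻¹ j<))
  ... | inj₁ j<n  = subst (Slot ∘ suc) (toℕ-fromℕ< j<n) (vertex (fromℕ< j<n))
  ... | inj₂ refl = back

  at-unroll-vertex : ∀ D u → at (unroll D) (suc (toℕ u)) ≡ D u
  at-unroll-vertex D u = trans (at-tabulate-++ D _ (toℕ<n u)) (cong D (fromℕ<-toℕ u (toℕ<n u)))

  at-unroll-back : ∀ D → at (unroll D) (suc n) ≡ D zero
  at-unroll-back D = at-tabulate-++-end D _

  data Place : Fin n → Set where
    first  : Place zero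
    inner  : ∀ u → 1 ≤ toℕ u → toℕ u < m → Place u
    final  : Place last

  place : ∀ u → Place u
  place u with toℕ u in u≡ | m≤n⇒m<n∨m≡n (s≤s⁻¹ (toℕ<n u))
  ... | zero  | _        = subst Place (toℕ-injective {j = u} (sym u≡)) first
  ... | suc _ | inj₁ u<m = inner u (subst (1 ≤_) (sym u≡) (s≤s z≤n)) (subst (_< m) (sym u≡) u<m)
  ... | suc _ | inj₂ u≡m = subst Place (toℕ-injective {j = u} (trans (toℕ-fromℕ m) (sym (trans u≡ u≡m)))) final

  dominates-inner : ∀ v u → 1 ≤ toℕ u → toℕ u < m → dominates G v u ≡ inWindow (toℕ v) (suc (toℕ u))
  dominates-inner v u = dominatesℕ-interior (toℕ<n v)

  module _ (D : Position n) (ends : D last ≡ true × D zero ≡ true) where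

    private
      last-dom = proj₁ ends
      zero-dom = proj₂ ends

      not-false : ∀ {u} {A : Set} → D u ≡ true → D u ≡ false → A
      not-false dom undom = contradiction (trans (sym dom) undom) λ ()

      within-unroll : ∀ v → 2 + toℕ v < length (unroll D)
      within-unroll v = subst (2 + toℕ v <_) (sym (length-unroll D)) (s≤s (s≤s (toℕ<n v)))

    unroll-play : ∀ v → unroll (play G D v) ≡ playAt (toℕ v) (unroll D)
    unroll-play v = at-extensionality (unroll (play G D v)) (playAt (toℕ v) (unroll D))
      (trans (length-unroll (play G D v)) (sym (trans (length-playAt (toℕ v) (unroll D)) (length-unroll D))))
      λ i i< → trans (pointwise (slot (subst (i <_) (length-unroll (play G D v)) i<)))
                     (sym (at-playAt (toℕ v) (unroll D) i (within-unroll v)))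
      where
      pointwise : ∀ {i} → Slot i → at (unroll (play G D v)) i ≡ at (unroll D) i ∨ inWindow (toℕ v) i
      pointwise front      = ∨-cong-false (D last) (not-false last-dom)
      pointwise back       = trans (at-unroll-back (play G D v))
                               (trans (∨-cong-false (D zero) (not-false zero-dom)) (cong (_∨ _) (sym (at-unroll-back D))))
      pointwise (vertex u) = trans (at-unroll-vertex (play G D v) u)
                               (trans (at-place (place u)) (cong (_∨ _) (sym (at-unroll-vertex D u))))
        where
        at-place : ∀ {u} → Place u → D u ∨ dominates G v u ≡ D u ∨ inWindow (toℕ v) (suc (toℕ u))
        at-place first              = ∨-cong-false (D zero) (not-false zero-dom)
        at-place final              = ∨-cong-false (D last) (not-false last-dom)
        at-place (inner u lo hi)    = cong (D u ∨_) (dominates-inner v u lo hi)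

    playable⇒playableAt : ∀ v → T (playable G D v) → T (playableAt (toℕ v) (unroll D))
    playable⇒playableAt v pv with u , dom , undom ← playable⁻ G D v pv =
      playableAt⁺ (toℕ v) (unroll D) (suc (toℕ u)) (within-unroll v) (in-window (place u) dom undom)
        (trans (at-unroll-vertex D u) undom)
      where
      in-window : ∀ {u} → Place u → T (dominates G v u) → D u ≡ false → T (inWindow (toℕ v) (suc (toℕ u)))
      in-window first           _   undom = not-false zero-dom undom
      in-window final           _   undom = not-false last-dom undom
      in-window (inner u lo hi) dom _     = subst T (dominates-inner v u lo hi) dom

    playableAt⇒playable : ∀ v → T (playableAt (toℕ v) (unroll D)) → T (playable G D v)
    playableAt⇒playable v p with fits , i , inW , undom ← playableAt⁻ (toℕ v) (unroll D) p =
      from-slot (slot (≤-<-trans (inWindow-≤ (toℕ v) i inW) (subst (2 + toℕ v <_) (length-unroll D) fits))) inW undom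
      where
      from-place : ∀ {u} → Place u → T (inWindow (toℕ v) (suc (toℕ u))) → D u ≡ false → T (playable G D v)
      from-place first           _   undom = not-false zero-dom undom
      from-place final           _   undom = not-false last-dom undom
      from-place (inner u lo hi) inW undom = playable⁺ G D v u (subst T (sym (dominates-inner v u lo hi)) inW) undom
      from-slot : ∀ {i} → Slot i → T (inWindow (toℕ v) i) → at (unroll D) i ≡ false → T (playable G D v)
      from-slot front      _   undom = not-false last-dom undom
      from-slot back       _   undom = not-false zero-dom (trans (sym (at-unroll-back D)) undom)
      from-slot (vertex u) inW undom = from-place (place u) inW (trans (sym (at-unroll-vertex D u)) undom)

  rotate : Fin n → Fin n
  rotate v = fromℕ< (next<n (toℕ v))

  toℕ-rotate : ∀ v → toℕ (rotate v) ≡ next (toℕ v)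
  toℕ-rotate v = toℕ-fromℕ< (next<n (toℕ v))

  rotate-dominates : ∀ v u → dominates G (rotate v) (rotate u) ≡ dominates G v u
  rotate-dominates v u =
    trans (cong₂ dominatesℕ (toℕ-rotate v) (toℕ-rotate u)) (dominatesℕ-next (toℕ<n v) (toℕ<n u))

  rotate-surjective : ∀ w → ∃ λ v → rotate v ≡ w
  rotate-surjective zero    = last , toℕ-injective (trans (toℕ-rotate last) (trans (cong next (toℕ-fromℕ m)) next-last))
  rotate-surjective (suc w) = inject₁ w , toℕ-injective
    (trans (toℕ-rotate (inject₁ w)) (trans (cong next (toℕ-inject₁ w)) (next-< (toℕ<n w))))

  rotations : ℕ → Fin n
  rotations zero    = zero
  rotations (suc k) = rotate (rotations k)

  toℕ-rotations : ∀ {k} → k < n → toℕ (rotations k) ≡ k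
  toℕ-rotations {zero}  _         = refl
  toℕ-rotations {suc k} (s≤s k<m) =
    trans (toℕ-rotate (rotations k)) (trans (cong next (toℕ-rotations (≤-trans (n≤1+n _) (s≤s k<m)))) (next-< k<m))

  open Automorphism G rotate rotate-dominates rotate-surjective using (nimberB-σ)

  first-moves-alike : ∀ f v → nimberB f G (play G start v) ≡ nimberB f G (play G start zero)
  first-moves-alike f v =
    subst (λ w → nimberB f G (play G start w) ≡ _) (toℕ-injective (toℕ-rotations (toℕ<n v))) (from-rotations (toℕ v))
    where
    from-rotations : ∀ k → nimberB f G (play G start (rotations k)) ≡ nimberB f G (play G start zero)
    from-rotations zero    = refl
    from-rotations (suc k) =
      trans (sym (nimberB-σ f (λ u → cong (false ∨_) (sym (rotate-dominates (rotations k) u))))) (from-rotations k)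

  ends-dominated : ∀ D → Separated (unroll D) → D last ≡ true × D zero ≡ true
  ends-dominated D s with _ , eq ← Separated-head s = ∷-injectiveˡ eq , ∷-injectiveˡ (∷-injectiveʳ eq)

  module _ (D : Position n) (s : Separated (unroll D)) (v : Fin n) (pv : T (playable G D v)) where

    private
      unroll-play′ : unroll (play G D v) ≡ playAt (toℕ v) (unroll D)
      unroll-play′ = unroll-play D (ends-dominated D s) v

      outcome : Separated (playAt (toℕ v) (unroll D)) × runNimber (playAt (toℕ v) (unroll D)) ≢ runNimber (unroll D)
      outcome = playAt-separated s (toℕ v) (playable⇒playableAt D (ends-dominated D s) v pv)

    separated-play : Separated (unroll (play G D v))
    separated-play = subst Separated (sym unroll-play′) (proj₁ outcome)

    undominated-play : undominated (unroll (play G D v)) < undominated (unroll D)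
    undominated-play = subst (λ w → undominated w < _) (sym unroll-play′)
      (playAt-undominated< (toℕ v) (unroll D) (playable⇒playableAt D (ends-dominated D s) v pv))

    runNimber-play : runNimber (unroll (play G D v)) ≢ runNimber (unroll D)
    runNimber-play eq = proj₂ outcome (trans (cong runNimber (sym unroll-play′)) eq)

  runNimber-reach : ∀ {D i} → Separated (unroll D) → i < toℕ₄ (runNimber (unroll D)) →
                    ∃ λ v → T (playable G D v) × toℕ₄ (runNimber (unroll (play G D v))) ≡ i
  runNimber-reach {D} {i} s i< = via-word (playAt-reaches s (x ⊕ fromℕ₄ i) (topDigit-below x (fromℕ₄ i) y<x))
    where
    open ≡-Reasoning
    x : Nim₄
    x = runNimber (unroll D)
    i≡ : toℕ₄ (fromℕ₄ i) ≡ i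
    i≡ = toℕ₄-fromℕ₄ x i<
    y<x : toℕ₄ (fromℕ₄ i) < toℕ₄ x
    y<x = subst (_< toℕ₄ x) (sym i≡) i<
    ends = ends-dominated D s
    via-word : (∃ λ c → T (playableAt c (unroll D)) × runNimber (playAt c (unroll D)) ≡ x ⊕ (x ⊕ fromℕ₄ i)) →
               ∃ λ v → T (playable G D v) × toℕ₄ (runNimber (unroll (play G D v))) ≡ i
    via-word (c , pc , eq) =
      v , playableAt⇒playable D ends v (subst (λ c → T (playableAt c (unroll D))) (sym v≡c) pc) , (begin
        toℕ₄ (runNimber (unroll (play G D v)))          ≡⟨ cong (toℕ₄ ∘ runNimber) (unroll-play D ends v) ⟩
        toℕ₄ (runNimber (playAt (toℕ v) (unroll D)))    ≡⟨ cong (λ c → toℕ₄ (runNimber (playAt c (unroll D)))) v≡c ⟩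
        toℕ₄ (runNimber (playAt c (unroll D)))          ≡⟨ cong toℕ₄ (trans eq (⊕-cancelˡ x (fromℕ₄ i))) ⟩
        toℕ₄ (fromℕ₄ i)                                 ≡⟨ i≡ ⟩
        i                                               ∎)
      where
      c<n : c < n
      c<n = s≤s⁻¹ (s≤s⁻¹ (subst (2 + c <_) (length-unroll D) (proj₁ (playableAt⁻ c (unroll D) pc))))
      v = fromℕ< c<n
      v≡c = toℕ-fromℕ< c<n

  open GrundyCharacterisation G (Separated ∘ unroll) (undominated ∘ unroll) (toℕ₄ ∘ runNimber ∘ unroll)
    (λ {D} {v} s → separated-play D s v) (λ {D} {v} s → undominated-play D s v)
    (λ {D} {v} s pv → runNimber-play D s v pv ∘ toℕ₄-injective) runNimber-reach

  nimberB-cycle : ∀ f {D} → Separated (unroll D) → undominated (unroll D) ≤ f →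
                  nimberB f G D ≡ toℕ₄ (runNimber (unroll D))
  nimberB-cycle = nimberB≡value

-- The first move

module Opening (k : ℕ) where
  open Cycle (2 + k)

  opening : Position n
  opening = play G start zero

  opening-word : List Bool
  opening-word = true ∷ true ∷ true ∷ gap k ++ true ∷ true ∷ []

  unroll-opening : unroll opening ≡ opening-word
  unroll-opening = at-extensionality (unroll opening) opening-word
    (trans (length-unroll opening)
      (sym (cong (3 +_) (trans (length-++ (gap k)) (trans (cong (_+ 2) (length-replicate k)) (+-comm k 2))))))
    λ i i< → pointwise (slot (subst (i <_) (length-unroll opening) i<))
    where
    last-dominated : dominates G zero last ≡ true
    last-dominated = trans (cong (dominatesℕ 0) (toℕ-fromℕ (2 + k))) (cong (_≡ᵇ 0) next-last)
    at-word-final : at opening-word (suc (toℕ last)) ≡ true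
    at-word-final = trans (cong (λ j → at opening-word (suc j)) (toℕ-fromℕ (2 + k)))
      (subst (λ j → at (gap k ++ true ∷ true ∷ []) j ≡ true) (+-identityʳ k) (at-gap-+ k _ 0))
    at-word-back : at opening-word (suc n) ≡ true
    at-word-back = subst (λ j → at (gap k ++ true ∷ true ∷ []) j ≡ true) (+-comm k 1) (at-gap-+ k _ 1)
    at-word-inner : ∀ {j} → 1 ≤ j → j < 2 + k → at opening-word (suc j) ≡ inWindow 0 (suc j)
    at-word-inner {1}           _ _               = refl
    at-word-inner {suc (suc r)} _ (s≤s (s≤s r<k)) = at-gap-< (true ∷ true ∷ []) r<k
    by-place : ∀ {u} → Place u → dominates G zero u ≡ at opening-word (suc (toℕ u))
    by-place first           = refl
    by-place final           = trans last-dominated (sym at-word-final)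
    by-place (inner u lo hi) = trans (dominates-inner zero u lo hi) (sym (at-word-inner lo hi))
    pointwise : ∀ {i} → Slot i → at (unroll opening) i ≡ at opening-word i
    pointwise front      = last-dominated
    pointwise back       = trans (at-unroll-back opening) (sym at-word-back)
    pointwise (vertex u) = trans (at-unroll-vertex opening u) (by-place (place u))

  nimberB-opening : nimberB n G opening ≡ toℕ₄ (residue₄ k)
  nimberB-opening = begin
    nimberB n G opening                ≡⟨ nimberB-cycle n {opening} separated bound ⟩
    toℕ₄ (runNimber (unroll opening))  ≡⟨ cong (toℕ₄ ∘ runNimber) unroll-opening ⟩
    toℕ₄ (runNimber opening-word)      ≡⟨ cong toℕ₄ (trans (runNimber-gap k (true ∷ [])) (⊕-identityʳ _)) ⟩
    toℕ₄ (residue₄ k)                  ∎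
    where
    open ≡-Reasoning
    separated : Separated (unroll opening)
    separated = subst Separated (sym unroll-opening) (dom∷ (gap∷ k end))
    bound : undominated (unroll opening) ≤ n
    bound = subst (λ w → undominated w ≤ n) (sym unroll-opening)
      (≤-trans (≤-reflexive (trans (undominated-gap k _) (+-identityʳ k))) (m≤n+m k 3))

  gameNimber-cycle : (residue₄ k ≡ 0₄ → gameNimber G ≡ 1) × (residue₄ k ≢ 0₄ → gameNimber G ≡ 0)
  gameNimber-cycle =
    (λ r≡0 → nimberB-moves-to-0 G start n _ all-alike zero (playable⁺ G start zero zero _ refl) (cong toℕ₄ r≡0)) ,
    (λ r≢0 → nimberB-moves-to-nonzero G start n _ all-alike (r≢0 ∘ toℕ₄-injective))
    where
    all-alike : ∀ v → T (playable G start v) → nimberB n G (play G start v) ≡ toℕ₄ (residue₄ k)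
    all-alike v _ = trans (first-moves-alike n v) nimberB-opening

  aliceWins⇔ : AliceWins G ⇔ residue₄ k ≡ 0₄
  aliceWins⇔ = mk⇔ to from
    where
    open Equivalence (playerToMoveWins⇔ G start) renaming (to to nonzero; from to wins)
    to : AliceWins G → residue₄ k ≡ 0₄
    to alice with toℕ₄ (residue₄ k) ≟ 0
    ... | yes ≡0 = toℕ₄-injective ≡0
    ... | no ≢0  = contradiction (proj₂ gameNimber-cycle (≢0 ∘ cong toℕ₄)) (nonzero alice)
    from : residue₄ k ≡ 0₄ → AliceWins G
    from r≡0 = wins λ ≡0 → contradiction (trans (sym (proj₁ gameNimber-cycle r≡0)) ≡0) λ ()

theorem4 : (n : ℕ) → 3 ≤ n →
    ((n % 4 ≡ 3 → gameNimber (cycle n) ≡ 1) × (¬ (n % 4 ≡ 3) → gameNimber (cycle n) ≡ 0))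
    × (AliceWins (cycle n) ⇔ (n % 4 ≡ 3))
theorem4 (suc (suc (suc k))) (s≤s (s≤s (s≤s z≤n))) =
  (proj₁ gameNimber-cycle ∘ from , λ ≢3 → proj₂ gameNimber-cycle (≢3 ∘ to)) , residue₄≡0⇔ k ⇔-∘ aliceWins⇔
  where
  open Opening k
  open Equivalence (residue₄≡0⇔ k)
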